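{- Let $P$ be a finite poset, let $P^*\subseteq P$ be a subset containing all minimal elements of $P$, and let $\lambda,\mu\colon P^*\to\mathbb{R}$ be two order-preserving maps (markings). Let $\tilde P=P\setminus P^*=C\sqcup O$ be any partition. Then \[\mathcal{O}_{C,O}(P,\lambda)+\mathcal{O}_{C,O}(P,\mu)\subseteq\mathcal{O}_{C,O}(P,\lambda+\mu)\quad\text{and}\quad \mathcal{O}^{\mathbb{Z}}_{C,O}(P,\lambda)+\mathcal{O}^{\mathbb{Z}}_{C,O}(P,\mu)\subseteq\mathcal{O}^{\mathbb{Z}}_{C,O}(P,\lambda+\mu),\] where $+$ denotes Minkowski sum.
   Context: For a finite poset $P$, write $p\prec q$ for a covering relation. A marked poset $(P,\lambda)$ consists of a subset $P^*\subseteq P$ of marked elements (regarded as an induced subposet) and an order-preserving map $\lambda\colon P^*\to\mathbb{R}$, the marking; it is assumed that $\min(P)\subseteq P^*$. Put $\tilde P=P\setminus P^*$. For a partition $\tilde P=C\sqcup O$, the marked chain-order polyhedron $\mathcal{O}_{C,O}(P,\lambda)\subseteq\mathbb{R}^P$ is the set of all $\mathbf{x}=(x_p)_{p\in P}$ such that: (1) $x_a=\lambda(a)$ for all $a\in P^*$; (2) $x_p\ge 0$ for all $p\in C$; (3) for every saturated chain $a\prec p_1\prec\cdots\prec p_r\prec b$ with $a,b\in P^*\sqcup O$, all $p_i\in C$ and $r\ge 0$, one has $x_{p_1}+\cdots+x_{p_r}\le x_b-x_a$. For a polyhedron $Q\subseteq\mathbb{R}^P$, $Q^{\mathbb{Z}}=Q\cap\mathbb{Z}^P$.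 -}

module Defs where

open import Level using (Level; _⊔_; suc)
open import Data.Nat using (ℕ; zero) renaming (suc to sucℕ)
open import Data.Integer using (ℤ; +_; -[1+_])
open import Data.Fin using (Fin)
open import Data.List using (List; []; _∷_)
open import Data.List.Relation.Unary.All using (All)
open import Data.Product using (_×_; Σ)
open import Relation.Nullary using (¬_)
open import Relation.Binary.PropositionalEquality using (_≡_)
open import Relation.Binary.Structures using (IsTotalOrder; IsPartialOrder)
open import Algebra.Bundles using (CommutativeRing)

-- An ordered commutative ring (ℝ is the instance relevant to the paper).
record OrderedCommutativeRing (c ℓ₁ ℓ₂ : Level) : Set (Level.suc (c ⊔ ℓ₁ ⊔ ℓ₂)) where
  field
    commutativeRing : CommutativeRing c ℓ₁
  open CommutativeRing commutativeRing public
  field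
    _≤_          : Carrier → Carrier → Set ℓ₂
    isTotalOrder : IsTotalOrder _≈_ _≤_
    +-monoʳ-≤    : ∀ {x y} z → x ≤ y → (z + x) ≤ (z + y)
    *-nonneg     : ∀ {x y} → 0# ≤ x → 0# ≤ y → 0# ≤ (x * y)

  fromℕ : ℕ → Carrier
  fromℕ zero     = 0#
  fromℕ (sucℕ n) = 1# + fromℕ n

  fromℤ : ℤ → Carrier
  fromℤ (+ n)      = fromℕ n
  fromℤ -[1+ n ]   = - fromℕ (sucℕ n)

-- Each element of P is either marked (in P*), in C, or in O.
-- This encodes P* together with the partition P \ P* = C ⊔ O.
data Kind : Set where
  marked chainK orderK : Kind

module MarkedChainOrder
  {c ℓ₁ ℓ₂ : Level} (R : OrderedCommutativeRing c ℓ₁ ℓ₂)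
  {n : ℕ} (_⊑_ : Fin n → Fin n → Set) (kind : Fin n → Kind) where

  open OrderedCommutativeRing R

  _⊏_ : Fin n → Fin n → Set
  p ⊏ q = (p ⊑ q) × ¬ (p ≡ q)

  _⋖_ : Fin n → Fin n → Set
  p ⋖ q = (p ⊏ q) × (∀ r → ¬ ((p ⊏ r) × (r ⊏ q)))

  IsMinimal : Fin n → Set
  IsMinimal p = ∀ q → q ⊑ p → q ≡ p

  -- saturated chain  a ⋖ p₁ ⋖ ⋯ ⋖ p_r ⋖ b  with interior list (p₁ … p_r)
  data SatChain : Fin n → List (Fin n) → Fin n → Set where
    done : ∀ {a b} → a ⋖ b → SatChain a [] b
    step : ∀ {a p ps b} → a ⋖ p → SatChain p ps b → SatChain a (p ∷ ps) b

  -- marking: values of λ outside P* are irrelevant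
  OrderPreserving : (Fin n → Carrier) → Set ℓ₂
  OrderPreserving l = ∀ p q → kind p ≡ marked → kind q ≡ marked → p ⊑ q → l p ≤ l q

  sumOver : (Fin n → Carrier) → List (Fin n) → Carrier
  sumOver x []       = 0#
  sumOver x (p ∷ ps) = x p + sumOver x ps

  record InPolyhedron (l : Fin n → Carrier) (x : Fin n → Carrier) : Set (c ⊔ ℓ₁ ⊔ ℓ₂) where
    field
      marked-eq : ∀ a → kind a ≡ marked → x a ≈ l a
      chain-nonneg : ∀ p → kind p ≡ chainK → 0# ≤ x p
      chain-ineq : ∀ a b ps → ¬ (kind a ≡ chainK) → ¬ (kind b ≡ chainK) →
                   All (λ p → kind p ≡ chainK) ps → SatChain a ps b →
                   sumOver x ps ≤ (x b - x a)

  IsIntegral : (Fin n → Carrier) → Set ℓ₁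
  IsIntegral x = ∀ p → Σ ℤ (λ k → x p ≈ fromℤ k)

  InLatticePoints : (Fin n → Carrier) → (Fin n → Carrier) → Set (c ⊔ ℓ₁ ⊔ ℓ₂)
  InLatticePoints l x = InPolyhedron l x × IsIntegral x

  _⊕_ : (Fin n → Carrier) → (Fin n → Carrier) → (Fin n → Carrier)
  (x ⊕ y) p = x p + y p

module Submission where

-- Every defining condition of O_{C,O}(P, λ) is an affine (in)equality in x
-- whose dependence on the marking is additive: x_a = λ(a) on P*, x_p ≥ 0 on
-- C, and  x_{p₁} + ⋯ + x_{p_r} ≤ x_b − x_a  along saturated chains.  Adding
-- such a condition for (x, λ) to the same condition for (y, μ) yields it for
-- (x + y, λ + μ).

open import Defs
open import Level using (Level)
open import Data.Nat using (ℕ; zero; suc; z≤n) renaming (_+_ to _+ℕ_)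
import Data.Nat.Properties as ℕP
open import Data.Integer using (+_; -[1+_]; _⊖_) renaming (_+_ to _+ℤ_)
import Data.Integer.Properties as ℤP
open import Data.Fin using (Fin)
open import Data.List using ([]; _∷_)
open import Data.List.Relation.Unary.All using (All)
open import Data.Product using (_×_; _,_)
open import Relation.Nullary using (¬_)
open import Relation.Binary.PropositionalEquality using (_≡_)
import Relation.Binary.PropositionalEquality as ≡
open import Relation.Binary.Structures using (IsPartialOrder; IsTotalOrder)
import Algebra.Properties.Group as GroupProperties
import Algebra.Properties.AbelianGroup as AbelianGroupProperties
import Algebra.Properties.CommutativeSemigroup as CommutativeSemigroupProperties
import Relation.Binary.Reasoning.Setoid as SetoidReasoning

module OrderedRingFacts {c ℓ₁ ℓ₂ : Level} (R : OrderedCommutativeRing c ℓ₁ ℓ₂) where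
  open OrderedCommutativeRing R hiding (zero)
  open IsTotalOrder isTotalOrder using () renaming (trans to ≤-trans; reflexive to ≈⇒≤)
  open GroupProperties +-group using (ε⁻¹≈ε)
  open AbelianGroupProperties +-abelianGroup using (⁻¹-∙-comm)
  open CommutativeSemigroupProperties +-commutativeSemigroup using (interchange)
  open SetoidReasoning setoid

  +-monoˡ-≤ : ∀ {x y} z → x ≤ y → (x + z) ≤ (y + z)
  +-monoˡ-≤ {x} {y} z x≤y =
    ≤-trans (≈⇒≤ (+-comm x z)) (≤-trans (+-monoʳ-≤ z x≤y) (≈⇒≤ (+-comm z y)))

  +-mono-≤ : ∀ {a b c d} → a ≤ b → c ≤ d → (a + c) ≤ (b + d)
  +-mono-≤ {b = b} {c = c} a≤b c≤d = ≤-trans (+-monoˡ-≤ c a≤b) (+-monoʳ-≤ b c≤d)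

  nonneg-+ : ∀ {a b} → 0# ≤ a → 0# ≤ b → 0# ≤ (a + b)
  nonneg-+ 0≤a 0≤b = ≤-trans (≈⇒≤ (sym (+-identityˡ 0#))) (+-mono-≤ 0≤a 0≤b)

  sub-+-interchange : ∀ a b c d → ((a - b) + (c - d)) ≈ ((a + c) - (b + d))
  sub-+-interchange a b c d = begin
    (a - b) + (c - d)     ≈⟨ interchange a (- b) c (- d) ⟩
    (a + c) + (- b + - d) ≈⟨ +-congˡ (⁻¹-∙-comm b d) ⟩
    (a + c) - (b + d)     ∎

  fromℕ-+ : ∀ m n → fromℕ (m +ℕ n) ≈ (fromℕ m + fromℕ n)
  fromℕ-+ zero    n = sym (+-identityˡ (fromℕ n))
  fromℕ-+ (suc m) n = begin
    1# + fromℕ (m +ℕ n)       ≈⟨ +-congˡ (fromℕ-+ m n) ⟩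
    1# + (fromℕ m + fromℕ n)  ≈⟨ sym (+-assoc 1# (fromℕ m) (fromℕ n)) ⟩
    (1# + fromℕ m) + fromℕ n  ∎

  fromℤ-⊖ : ∀ m n → fromℤ (m ⊖ n) ≈ (fromℕ m - fromℕ n)
  fromℤ-⊖ m zero rewrite ℤP.⊖-≥ {m} {zero} z≤n = begin
    fromℕ m       ≈⟨ sym (+-identityʳ (fromℕ m)) ⟩
    fromℕ m + 0#  ≈⟨ +-congˡ (sym ε⁻¹≈ε) ⟩
    fromℕ m - 0#  ∎
  fromℤ-⊖ zero    (suc n) = sym (+-identityˡ _)
  fromℤ-⊖ (suc m) (suc n) rewrite ℤP.[1+m]⊖[1+n]≡m⊖n m n = begin
    fromℤ (m ⊖ n)                    ≈⟨ fromℤ-⊖ m n ⟩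
    fromℕ m - fromℕ n                ≈⟨ sym (+-identityˡ _) ⟩
    0# + (fromℕ m - fromℕ n)         ≈⟨ +-congʳ (sym (-‿inverseʳ 1#)) ⟩
    (1# - 1#) + (fromℕ m - fromℕ n)  ≈⟨ sub-+-interchange 1# 1# (fromℕ m) (fromℕ n) ⟩
    (1# + fromℕ m) - (1# + fromℕ n)  ∎

  fromℤ-+ : ∀ i j → fromℤ (i +ℤ j) ≈ (fromℤ i + fromℤ j)
  fromℤ-+ (+ m)    (+ n)    = fromℕ-+ m n
  fromℤ-+ (+ m)    -[1+ n ] = fromℤ-⊖ m (suc n)
  fromℤ-+ -[1+ m ] (+ n)    = trans (fromℤ-⊖ n (suc m)) (+-comm _ _)
  fromℤ-+ -[1+ m ] -[1+ n ] = begin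
    - fromℕ (suc (suc (m +ℕ n)))         ≡⟨ ≡.cong (λ k → - fromℕ (suc k)) (ℕP.+-suc m n) ⟨
    - fromℕ (suc m +ℕ suc n)             ≈⟨ -‿cong (fromℕ-+ (suc m) (suc n)) ⟩
    - (fromℕ (suc m) + fromℕ (suc n))    ≈⟨ ⁻¹-∙-comm (fromℕ (suc m)) (fromℕ (suc n)) ⟨
    - fromℕ (suc m) + - fromℕ (suc n)    ∎

module MinkowskiSum
  {c ℓ₁ ℓ₂ : Level} (R : OrderedCommutativeRing c ℓ₁ ℓ₂)
  {n : ℕ} (_⊑_ : Fin n → Fin n → Set) (kind : Fin n → Kind) where
  open OrderedCommutativeRing R hiding (zero)
  open IsTotalOrder isTotalOrder using () renaming (trans to ≤-trans; reflexive to ≈⇒≤)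
  open CommutativeSemigroupProperties +-commutativeSemigroup using (interchange)
  open SetoidReasoning setoid
  open OrderedRingFacts R
  open MarkedChainOrder R _⊑_ kind

  sumOver-⊕ : ∀ x y ps → sumOver (x ⊕ y) ps ≈ (sumOver x ps + sumOver y ps)
  sumOver-⊕ x y []       = sym (+-identityˡ 0#)
  sumOver-⊕ x y (p ∷ ps) = begin
    (x p + y p) + sumOver (x ⊕ y) ps             ≈⟨ +-congˡ (sumOver-⊕ x y ps) ⟩
    (x p + y p) + (sumOver x ps + sumOver y ps)  ≈⟨ interchange (x p) (y p) _ _ ⟩
    (x p + sumOver x ps) + (y p + sumOver y ps)  ∎

  InPolyhedron-⊕ : ∀ {l m x y} → InPolyhedron l x → InPolyhedron m y →
                   InPolyhedron (l ⊕ m) (x ⊕ y)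
  InPolyhedron-⊕ {x = x} {y} X Y = record
    { marked-eq    = λ a a∈P* → +-cong (X.marked-eq a a∈P*) (Y.marked-eq a a∈P*)
    ; chain-nonneg = λ p p∈C → nonneg-+ (X.chain-nonneg p p∈C) (Y.chain-nonneg p p∈C)
    ; chain-ineq   = chain-ineq
    }
    where
    module X = InPolyhedron X
    module Y = InPolyhedron Y

    chain-ineq : ∀ a b ps → ¬ (kind a ≡ chainK) → ¬ (kind b ≡ chainK) →
                 All (λ p → kind p ≡ chainK) ps → SatChain a ps b →
                 sumOver (x ⊕ y) ps ≤ ((x b + y b) - (x a + y a))
    chain-ineq a b ps a∉C b∉C ps⊆C chain =
      ≤-trans (≈⇒≤ (sumOver-⊕ x y ps))
        (≤-trans (+-mono-≤ (X.chain-ineq a b ps a∉C b∉C ps⊆C chain)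
                           (Y.chain-ineq a b ps a∉C b∉C ps⊆C chain))
                 (≈⇒≤ (sub-+-interchange (x b) (x a) (y b) (y a))))

  IsIntegral-⊕ : ∀ {x y} → IsIntegral x → IsIntegral y → IsIntegral (x ⊕ y)
  IsIntegral-⊕ X Y p with X p | Y p
  ... | i , xp≈i | j , yp≈j = i +ℤ j , trans (+-cong xp≈i yp≈j) (sym (fromℤ-+ i j))

  InLatticePoints-⊕ : ∀ {l m x y} → InLatticePoints l x → InLatticePoints m y →
                      InLatticePoints (l ⊕ m) (x ⊕ y)
  InLatticePoints-⊕ (X , x∈ℤ) (Y , y∈ℤ) = InPolyhedron-⊕ X Y , IsIntegral-⊕ x∈ℤ y∈ℤ

lemma2p1 : {c ℓ₁ ℓ₂ : Level} (R : OrderedCommutativeRing c ℓ₁ ℓ₂)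
    {n : ℕ} (_⊑_ : Fin n → Fin n → Set) → IsPartialOrder _≡_ _⊑_ →
    (kind : Fin n → Kind) →
    (∀ p → MarkedChainOrder.IsMinimal R _⊑_ kind p → kind p ≡ marked) →
    (l m : Fin n → OrderedCommutativeRing.Carrier R) →
    MarkedChainOrder.OrderPreserving R _⊑_ kind l →
    MarkedChainOrder.OrderPreserving R _⊑_ kind m →
    (∀ x y → MarkedChainOrder.InPolyhedron R _⊑_ kind l x →
      MarkedChainOrder.InPolyhedron R _⊑_ kind m y →
      MarkedChainOrder.InPolyhedron R _⊑_ kind
        (MarkedChainOrder._⊕_ R _⊑_ kind l m) (MarkedChainOrder._⊕_ R _⊑_ kind x y))
    × (∀ x y → MarkedChainOrder.InLatticePoints R _⊑_ kind l x →
      MarkedChainOrder.InLatticePoints R _⊑_ kind m y →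
      MarkedChainOrder.InLatticePoints R _⊑_ kind
        (MarkedChainOrder._⊕_ R _⊑_ kind l m) (MarkedChainOrder._⊕_ R _⊑_ kind x y))
lemma2p1 R _⊑_ _ kind _ _ _ _ _ =
  (λ x y → InPolyhedron-⊕) , (λ x y → InLatticePoints-⊕)
  where open MinkowskiSum R _⊑_ kind
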